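{- Let $k\ge 2$, $c$ and $n$ be integers with $n\ge 1$. Let $f(x)=ax+b\in\mathbb{Z}[x]$ with $\gcd(a,n)=1$. Then $$\mathcal{N}_{k,f,c}(n)=n^{k-1}\prod_{p\mid n}\frac{(p-1)^k+(-1)^k\delta_p}{p^k},$$ where the product runs over the distinct prime divisors $p$ of $n$ and $$\delta_p=\begin{cases} p-1, & \text{if } p\mid (ac+kb),\\ -1, & \text{if } p\nmid (ac+kb).\end{cases}$$
   Context: For a positive integer $n$, $\mathbb{Z}_n=\{0,1,\dots,n-1\}$ denotes the ring of residue classes modulo $n$. For $f(x)\in\mathbb{Z}[x]$, let $E_f(n)=\{a\in\mathbb{Z}_n:\gcd(f(a),n)=1\}$ (the $f$-exunits in $\mathbb{Z}_n$), and $$\mathcal{N}_{k,f,c}(n)=\#\{(x_1,\dots,x_k)\in E_f(n)^k: x_1+\cdots+x_k\equiv c\pmod n\}.$$ -}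

module Defs where

open import Data.Nat as ℕ using (ℕ; zero; suc; NonZero)
open import Data.Nat.Divisibility as ℕD using ()
open import Data.Nat.Properties using (m^n≢0)
open import Data.Nat.Primality using (Prime; prime?)
import Data.Integer as ℤ
open ℤ using (ℤ; +_; -[1+_])
open import Data.Integer.GCD using (gcd)
open import Data.Integer.Divisibility.Signed using (_∣_; _∣?_)
open import Data.Fin using (Fin; toℕ)
open import Data.Vec using (Vec; []; _∷_)
open import Data.List using (List; []; _∷_; filter; length; map; concatMap; foldr; upTo; allFin)
open import Data.Rational as ℚ using (ℚ; 1ℚ)
open import Data.Product using (_×_)
open import Relation.Nullary using (Dec; yes; no; _×-dec_)
open import Relation.Nullary.Decidable using (Dec)
open import Relation.Binary.PropositionalEquality using (_≡_)
open import Data.List.Relation.Unary.All using (All; all?)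

linF : ℤ → ℤ → ℤ → ℤ
linF a b x = a ℤ.* x ℤ.+ b

rep : {n : ℕ} → Fin n → ℤ
rep i = + toℕ i

IsExunit : (a b : ℤ) (n : ℕ) → Fin n → Set
IsExunit a b n x = gcd (linF a b (rep x)) (+ n) ≡ + 1

isExunit? : (a b : ℤ) (n : ℕ) (x : Fin n) → Dec (IsExunit a b n x)
isExunit? a b n x = gcd (linF a b (rep x)) (+ n) ℤ.≟ + 1

allVecs : (n k : ℕ) → List (Vec (Fin n) k)
allVecs n zero = [] ∷ []
allVecs n (suc k) = concatMap (λ x → map (x ∷_) (allVecs n k)) (allFin n)

vsum : {n k : ℕ} → Vec (Fin n) k → ℤ
vsum [] = + 0
vsum (x ∷ xs) = rep x ℤ.+ vsum xs

allVec : {n k : ℕ} → (Fin n → Set) → Vec (Fin n) k → Set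
allVec P [] = Data.Unit.⊤ where import Data.Unit
allVec P (x ∷ xs) = P x × allVec P xs

allVec? : {n k : ℕ} {P : Fin n → Set} → ((x : Fin n) → Dec (P x)) → (v : Vec (Fin n) k) → Dec (allVec P v)
allVec? d [] = yes Data.Unit.tt where import Data.Unit
allVec? d (x ∷ xs) = d x ×-dec allVec? d xs

Good : (a b c : ℤ) (n k : ℕ) → Vec (Fin n) k → Set
Good a b c n k v = allVec (IsExunit a b n) v × ((+ n) ∣ (vsum v ℤ.- c))

good? : (a b c : ℤ) (n k : ℕ) (v : Vec (Fin n) k) → Dec (Good a b c n k v)
good? a b c n k v = allVec? (isExunit? a b n) v ×-dec ((+ n) ∣? (vsum v ℤ.- c))

𝒩 : (k : ℕ) (a b c : ℤ) (n : ℕ) → ℕ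
𝒩 k a b c n = length (filter (good? a b c n k) (allVecs n k))

-- distinct prime divisors of n (for n ≥ 1 they all lie in {0,…,n})
primeDivisors : ℕ → List ℕ
primeDivisors n = filter (λ p → prime? p ×-dec (p ℕD.∣? n)) (upTo (suc n))

δ : (p k : ℕ) (a b c : ℤ) → ℤ
δ p k a b c with (+ p) ∣? (a ℤ.* c ℤ.+ (+ k) ℤ.* b)
... | yes _ = + p ℤ.- + 1
... | no  _ = -[1+ 0 ]

-- the factor ((p-1)^k + (-1)^k δ_p) / p^k ; p^k made nonzero by using suc-form when p = 0 (never happens for primes)
factor : (k : ℕ) (a b c : ℤ) (p : ℕ) → ℚ
factor k a b c zero = 1ℚ
factor k a b c (suc q) =
  ((+ q) ℤ.^ k ℤ.+ (-[1+ 0 ] ℤ.^ k) ℤ.* δ (suc q) k a b c) ℚ./ (suc q ℕ.^ k)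
  where instance _ = m^n≢0 (suc q) k

-- Substituting x ↦ a x + b, a permutation of ℤ_n because gcd(a, n) = 1, turns the f-exunit
-- k-tuples with sum c into the unit k-tuples with sum a c + k b.  The number U_n(k, m) of unit
-- k-tuples with sum m is multiplicative in n by the Chinese remainder theorem, and
-- U_{pq}(k, m) = p^(k-1) U_q(k, m) when p divides q.  For a prime p every nonzero residue is a
-- unit, so U_p(k + 1, m) + U_p(k, m) = (p - 1)^k, which solves to
-- p U_p(k, m) = (p - 1)^k + (-1)^k δ_p.  Peeling the primes of n off one at a time gives the
-- product formula.
module Submission where

open import Defs

module _ where

  open import Algebra.Bundles using (CommutativeMonoid)
  open import Data.Nat as ℕ using (ℕ; zero; suc; NonZero; _+_; _*_; _^_; _∸_; _<_; _≤_; s≤s)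
  import Data.Nat.Properties as ℕP
  open import Data.Nat.Divisibility as ℕD using () renaming (_∣_ to _∣ℕ_)
  open import Data.Nat.Coprimality as C using (Coprime; coprime?)
  open import Data.Nat.Primality
    using (Prime; prime?; ¬prime[1]; prime⇒nonZero; prime⇒nonTrivial; prime⇒irreducible;
           euclidsLemma; productOfPrimes≢0; productOfPrimes≥1)
  open import Data.Nat.Primality.Factorisation using (PrimeFactorisation; factorise)
  open import Data.Nat.ListAction using (product)
  open import Data.Integer as ℤ using (ℤ; +_; -[1+_]; ∣_∣)
  import Data.Integer.Properties as ℤP
  import Data.Integer.Coprimality as ℤCoprime
  open import Data.Integer.Divisibility.Signed as ℤD using (_∣_; divides; _∣?_; ∣ᵤ⇒∣; ∣⇒∣ᵤ)
  open import Data.Integer.DivMod using (_%ℕ_; n%ℕd<d; a≡a%ℕn+[a/ℕn]*n)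
  open import Data.Integer.GCD using (gcd)
  import Data.Integer.Tactic.RingSolver as ℤRing
  open import Data.Rational as ℚ using (ℚ; 1ℚ; _/_; fromℚᵘ)
  import Data.Rational.Properties as ℚP
  import Data.Rational.Unnormalised as ℚᵘ
  import Data.Rational.Unnormalised.Properties as ℚᵘP
  open import Data.Fin as Fin using (Fin; zero; suc; toℕ; fromℕ<; combine; _↑ˡ_; _↑ʳ_)
  import Data.Fin.Properties as FinP
  open import Data.Fin.Permutation using (Permutation; permutation)
  open import Data.Vec using ([]; _∷_)
  open import Data.List
    using (List; []; _∷_; _++_; length; filter; map; concatMap; tabulate; foldr; applyUpTo)
  import Data.List.Properties as ListP
  open import Data.List.Relation.Unary.All using (All; []; _∷_)
  open import Algebra.Properties.Semiring.Sum ℕP.+-*-semiring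
    using (sum-syntax; sum-cong-≗; sum-replicate-zero; ∑-comm; ∑-permute; *-distribˡ-sum; *-distribʳ-sum)
  open import Algebra.Properties.CommutativeSemigroup ℕP.*-commutativeSemigroup using (x∙yz≈y∙xz; x∙yz≈yx∙z)
  open import Algebra.Properties.CommutativeSemigroup
    (CommutativeMonoid.commutativeSemigroup ℚP.*-1-commutativeMonoid)
    using () renaming (interchange to ℚ-interchange)
  open import Data.Bool using (true; false; if_then_else_)
  open import Data.Product using (_×_; _,_; proj₁; proj₂; ∃)
  open import Data.Empty using (⊥-elim)
  open import Data.Sum using (inj₁; inj₂)
  open import Function using (id; _∘_; _⇔_; mk⇔; Equivalence)
  open import Function.Definitions using (Injective)
  open import Relation.Nullary using (Dec; yes; no; does; ¬_; _×-dec_)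
  open import Relation.Nullary.Decidable using (dec-true; dec-false; does-⇔)
  open import Relation.Unary using (Decidable)
  open import Relation.Binary.PropositionalEquality

  𝟙 : {P : Set} → Dec P → ℕ
  𝟙 P? = if does P? then 1 else 0

  𝟙-yes : {P : Set} (P? : Dec P) → P → 𝟙 P? ≡ 1
  𝟙-yes P? p rewrite dec-true P? p = refl

  𝟙-no : {P : Set} (P? : Dec P) → ¬ P → 𝟙 P? ≡ 0
  𝟙-no P? ¬p rewrite dec-false P? ¬p = refl

  𝟙-cong : {P Q : Set} → P ⇔ Q → (P? : Dec P) (Q? : Dec Q) → 𝟙 P? ≡ 𝟙 Q?
  𝟙-cong P⇔Q P? Q? = cong (λ b → if b then 1 else 0) (does-⇔ P⇔Q P? Q?)

  𝟙-×-dec : {P Q : Set} (P? : Dec P) (Q? : Dec Q) → 𝟙 (P? ×-dec Q?) ≡ 𝟙 P? * 𝟙 Q?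
  𝟙-×-dec (yes _) (yes _) = refl
  𝟙-×-dec (yes _) (no _)  = refl
  𝟙-×-dec (no _)  _       = refl

  ∑-single : ∀ n (f : Fin n → ℕ) r → (∀ i → i ≢ r → f i ≡ 0) → ∑[ i < n ] f i ≡ f r
  ∑-single (suc n) f zero f≡0 =
    trans (cong (_+_ (f zero)) (trans (sum-cong-≗ (λ i → f≡0 (suc i) λ ())) (sum-replicate-zero n)))
          (ℕP.+-identityʳ (f zero))
  ∑-single (suc n) f (suc r) f≡0 =
    cong₂ _+_ (f≡0 zero λ ()) (∑-single n (f ∘ suc) r (λ i i≢r → f≡0 (suc i) (i≢r ∘ FinP.suc-injective)))

  ∑∑-cong : ∀ m n {f g : Fin m → Fin n → ℕ} → (∀ i j → f i j ≡ g i j) →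
            ∑[ i < m ] ∑[ j < n ] f i j ≡ ∑[ i < m ] ∑[ j < n ] g i j
  ∑∑-cong m n f≡g = sum-cong-≗ (λ i → sum-cong-≗ (f≡g i))

  ∑-const : ∀ n c → ∑[ i < n ] c ≡ n * c
  ∑-const zero    c = refl
  ∑-const (suc n) c = cong (_+_ c) (∑-const n c)

  ∑-↑ : ∀ m n (f : Fin (m + n) → ℕ) →
        ∑[ x < m + n ] f x ≡ ∑[ i < m ] f (i ↑ˡ n) + ∑[ j < n ] f (m ↑ʳ j)
  ∑-↑ zero    n f = refl
  ∑-↑ (suc m) n f = trans (cong (_+_ (f zero)) (∑-↑ m n (f ∘ suc))) (sym (ℕP.+-assoc (f zero) _ _))

  ∑-combine : ∀ m n (f : Fin (m * n) → ℕ) → ∑[ x < m * n ] f x ≡ ∑[ i < m ] ∑[ j < n ] f (combine i j)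
  ∑-combine zero    n f = refl
  ∑-combine (suc m) n f =
    trans (∑-↑ n (m * n) f) (cong (_+_ (∑[ j < n ] f (j ↑ˡ m * n))) (∑-combine m n (f ∘ (n ↑ʳ_))))

  injective⇒surjective : ∀ {n} (h : Fin n → Fin n) → Injective _≡_ _≡_ h → ∀ j → ∃ λ i → h i ≡ j
  injective⇒surjective {zero}  h h-inj ()
  injective⇒surjective {suc n} h h-inj j with FinP.any? (λ i → h i Fin.≟ j)
  ... | yes hit = hit
  ... | no miss = ⊥-elim (ℕP.<-irrefl refl (FinP.injective⇒≤ punchOut-injective))
    where
    j≢h : ∀ i → j ≢ h i
    j≢h i j≡hi = miss (i , sym j≡hi)
    punchOut-injective : Injective _≡_ _≡_ (λ i → Fin.punchOut (j≢h i))
    punchOut-injective eq = h-inj (FinP.punchOut-injective (j≢h _) (j≢h _) eq)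

  ∑-injective : ∀ {n} (f : Fin n → ℕ) (h : Fin n → Fin n) → Injective _≡_ _≡_ h →
                ∑[ i < n ] f (h i) ≡ ∑[ i < n ] f i
  ∑-injective {n} f h h-inj = sym (∑-permute f π)
    where
    h⁻¹ : Fin n → Fin n
    h⁻¹ j = proj₁ (injective⇒surjective h h-inj j)
    π : Permutation n n
    π = permutation h h⁻¹ (proj₂ ∘ injective⇒surjective h h-inj)
                          (h-inj ∘ proj₂ ∘ injective⇒surjective h h-inj ∘ h)

  coprime-∣ʳ : ∀ {x m n} → m ∣ℕ n → Coprime x n → Coprime x m
  coprime-∣ʳ m∣n x⊥n (d∣x , d∣m) = x⊥n (d∣x , ℕD.∣-trans d∣m m∣n)

  coprime-∣ˡ : ∀ {x y m} → y ∣ℕ x → Coprime x m → Coprime y m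
  coprime-∣ˡ y∣x x⊥m (d∣y , d∣m) = x⊥m (ℕD.∣-trans d∣y y∣x , d∣m)

  coprime-* : ∀ {x m n} → Coprime x m → Coprime x n → Coprime x (m * n)
  coprime-* x⊥m x⊥n (d∣x , d∣mn) = x⊥n (d∣x , C.coprime-divisor (coprime-∣ˡ d∣x x⊥m) d∣mn)

  coprime-*⇔ : ∀ {x m n} → Coprime x (m * n) ⇔ (Coprime x m × Coprime x n)
  coprime-*⇔ {x} {m} {n} = mk⇔ {A = Coprime x (m * n)} {B = Coprime x m × Coprime x n}
    (λ x⊥mn → coprime-∣ʳ (ℕD.m∣m*n n) x⊥mn , coprime-∣ʳ (ℕD.n∣m*n m) x⊥mn)
    (λ (x⊥m , x⊥n) → coprime-* {x} {m} {n} x⊥m x⊥n)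

  coprime-*-∣⇔ : ∀ {x p q} → p ∣ℕ q → Coprime x (p * q) ⇔ Coprime x q
  coprime-*-∣⇔ {p = p} p∣q = mk⇔ (coprime-∣ʳ (ℕD.n∣m*n p)) (λ x⊥q → coprime-* (coprime-∣ʳ p∣q x⊥q) x⊥q)

  *-∣⇔ : ∀ {m n x} → Coprime m n → + (m * n) ∣ x ⇔ ((+ m ∣ x) × (+ n ∣ x))
  *-∣⇔ {m} {n} {x} m⊥n = mk⇔
    (λ mn∣x → ∣ᵤ⇒∣ (ℕD.m*n∣⇒m∣ m n (∣⇒∣ᵤ mn∣x)) , ∣ᵤ⇒∣ (ℕD.m*n∣⇒n∣ m n (∣⇒∣ᵤ mn∣x)))
    (λ (m∣x , n∣x) → ∣ᵤ⇒∣ (mn∣x m∣x n∣x))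
    where
    mn∣x : + m ∣ x → + n ∣ x → m * n ∣ℕ ∣ x ∣
    mn∣x m∣x n∣x with ∣⇒∣ᵤ n∣x
    ... | ℕD.divides q x≡qn = subst (m * n ∣ℕ_) (sym x≡qn) (ℕD.*-monoˡ-∣ n m∣q)
      where
      m∣q : m ∣ℕ q
      m∣q = C.coprime-divisor m⊥n (subst (m ∣ℕ_) (trans x≡qn (ℕP.*-comm q n)) (∣⇒∣ᵤ m∣x))

  prime-∣-prime : ∀ {p i} → Prime p → Prime i → i ∣ℕ p → i ≡ p
  prime-∣-prime p-prime i-prime i∣p with prime⇒irreducible p-prime i∣p
  ... | inj₁ refl = ⊥-elim (¬prime[1] i-prime)
  ... | inj₂ i≡p  = i≡p

  prime-∤⇒coprime : ∀ {p n} → Prime p → ¬ (p ∣ℕ n) → Coprime p n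
  prime-∤⇒coprime p-prime p∤n (d∣p , d∣n) with prime⇒irreducible p-prime d∣p
  ... | inj₁ d≡1  = d≡1
  ... | inj₂ refl = ⊥-elim (p∤n d∣n)

  infix 4 _≡_mod_

  -- A record rather than a synonym for the divisibility, so that x and y can be inferred.
  record _≡_mod_ (x y : ℤ) (N : ℕ) : Set where
    constructor ≡-mod
    field ∣-difference : + N ∣ x ℤ.- y

  open _≡_mod_ using (∣-difference)

  ≡-mod-sym : ∀ {N x y} → x ≡ y mod N → y ≡ x mod N
  ≡-mod-sym {x = x} {y} (≡-mod N∣x-y) = ≡-mod (subst (_ ∣_) (negate x y) (ℤD.∣m⇒∣-m N∣x-y))
    where
    negate : ∀ x y → ℤ.- (x ℤ.- y) ≡ y ℤ.- x
    negate = ℤRing.solve-∀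

  ≡-mod-trans : ∀ {N x y z} → x ≡ y mod N → y ≡ z mod N → x ≡ z mod N
  ≡-mod-trans {x = x} {y} {z} (≡-mod N∣x-y) (≡-mod N∣y-z) =
    ≡-mod (subst (_ ∣_) (telescope x y z) (ℤD.∣m∣n⇒∣m+n N∣x-y N∣y-z))
    where
    telescope : ∀ x y z → (x ℤ.- y) ℤ.+ (y ℤ.- z) ≡ x ℤ.- z
    telescope = ℤRing.solve-∀

  ≡-mod-+ʳ : ∀ {N x y} z → x ≡ y mod N → x ℤ.+ z ≡ y ℤ.+ z mod N
  ≡-mod-+ʳ {x = x} {y} z (≡-mod N∣x-y) = ≡-mod (subst (_ ∣_) (shift x y z) N∣x-y)
    where
    shift : ∀ x y z → x ℤ.- y ≡ (x ℤ.+ z) ℤ.- (y ℤ.+ z)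
    shift = ℤRing.solve-∀

  ≡-mod-reflect : ∀ {N x y} m → x ≡ y mod N → m ℤ.- x ≡ m ℤ.- y mod N
  ≡-mod-reflect {x = x} {y} m (≡-mod N∣x-y) = ≡-mod (subst (_ ∣_) (reflect m x y) (ℤD.∣m⇒∣-m N∣x-y))
    where
    reflect : ∀ m x y → ℤ.- (x ℤ.- y) ≡ (m ℤ.- x) ℤ.- (m ℤ.- y)
    reflect = ℤRing.solve-∀

  ≡-mod-cancel-*ˡ : ∀ {N a x y} → Coprime ∣ a ∣ N → a ℤ.* x ≡ a ℤ.* y mod N → x ≡ y mod N
  ≡-mod-cancel-*ˡ {N} {a} {x} {y} a⊥N (≡-mod N∣ax-ay) =
    ≡-mod (∣ᵤ⇒∣ (ℤCoprime.coprime-divisor (+ N) a (x ℤ.- y) (C.sym a⊥N)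
                                          (∣⇒∣ᵤ (subst (_ ∣_) (factor-out a x y) N∣ax-ay))))
    where
    factor-out : ∀ a x y → a ℤ.* x ℤ.- a ℤ.* y ≡ a ℤ.* (x ℤ.- y)
    factor-out = ℤRing.solve-∀

  ∣-resp-≡-mod : ∀ {N x y} → x ≡ y mod N → + N ∣ x → + N ∣ y
  ∣-resp-≡-mod {x = x} {y} (≡-mod N∣x-y) N∣x = subst (_ ∣_) (cancel x y) (ℤD.∣m∣n⇒∣m-n N∣x N∣x-y)
    where
    cancel : ∀ x y → x ℤ.- (x ℤ.- y) ≡ y
    cancel = ℤRing.solve-∀

  coprime-resp-≡-mod : ∀ {N x y} → x ≡ y mod N → Coprime ∣ x ∣ N → Coprime ∣ y ∣ N
  coprime-resp-≡-mod {N} {x} {y} (≡-mod N∣x-y) x⊥N {d} (d∣y , d∣N) = x⊥N (∣⇒∣ᵤ d∣x , d∣N)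
    where
    cancel : ∀ x y → y ℤ.+ (x ℤ.- y) ≡ x
    cancel = ℤRing.solve-∀
    d∣x : + d ∣ x
    d∣x = subst (_ ∣_) (cancel x y)
                (ℤD.∣m∣n⇒∣m+n (∣ᵤ⇒∣ {+ d} {y} d∣y) (ℤD.∣-trans (∣ᵤ⇒∣ {+ d} {+ N} d∣N) N∣x-y))

  ≡-mod⇒≡ : ∀ {N x y} → x < N → y < N → + x ≡ + y mod N → x ≡ y
  ≡-mod⇒≡ {x = x} {y} x<N y<N x≡y =
    ℕP.≤-antisym (≡-mod⇒≤ x<N x≡y) (≡-mod⇒≤ y<N (≡-mod-sym {x = + x} {+ y} x≡y))
    where
    ≡-mod⇒≤ : ∀ {N x y} → x < N → + x ≡ + y mod N → x ≤ y
    ≡-mod⇒≤ {N} {x} {y} x<N x≡y with ℕP.≤-total x y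
    ... | inj₁ x≤y = x≤y
    ... | inj₂ y≤x = ℕP.m∸n≡0⇒m≤n (small-multiple (ℕP.≤-<-trans (ℕP.m∸n≤m x y) x<N) N∣x∸y)
      where
      N∣x∸y : N ∣ℕ x ∸ y
      N∣x∸y = ∣⇒∣ᵤ (subst (_ ∣_) (trans (ℤP.m-n≡m⊖n x y) (ℤP.⊖-≥ y≤x)) (∣-difference x≡y))
      small-multiple : ∀ {d} → d < N → N ∣ℕ d → d ≡ 0
      small-multiple {zero}  _   _   = refl
      small-multiple {suc _} d<N N∣d = ⊥-elim (ℕD.>⇒∤ d<N N∣d)

  rep-≡-mod⇒≡ : ∀ {N} {i j : Fin N} → rep i ≡ rep j mod N → i ≡ j
  rep-≡-mod⇒≡ {i = i} {j} i≡j = FinP.toℕ-injective (≡-mod⇒≡ (FinP.toℕ<n i) (FinP.toℕ<n j) i≡j)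

  residue : ∀ N .{{_ : NonZero N}} → ℤ → Fin N
  residue N x = fromℕ< (n%ℕd<d x N)

  ≡-mod-residue : ∀ N .{{_ : NonZero N}} x → x ≡ rep (residue N x) mod N
  ≡-mod-residue N x = ≡-mod (divides (x ℤ./ℕ N) (begin
    x ℤ.- rep (residue N x)                      ≡⟨ cong (λ r → x ℤ.- + r) (FinP.toℕ-fromℕ< (n%ℕd<d x N)) ⟩
    x ℤ.- + (x %ℕ N)                             ≡⟨ cong (ℤ._- + (x %ℕ N)) (a≡a%ℕn+[a/ℕn]*n x N) ⟩
    + (x %ℕ N) ℤ.+ x ℤ./ℕ N ℤ.* + N ℤ.- + (x %ℕ N) ≡⟨ cancel (+ (x %ℕ N)) (x ℤ./ℕ N ℤ.* + N) ⟩
    x ℤ./ℕ N ℤ.* + N                             ∎))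
    where
    open ≡-Reasoning
    cancel : ∀ r t → r ℤ.+ t ℤ.- r ≡ t
    cancel = ℤRing.solve-∀

  rep-combine : ∀ {m n} (i : Fin m) (j : Fin n) → rep (combine i j) ≡ + n ℤ.* rep i ℤ.+ rep j
  rep-combine {n = n} i j = begin
    + toℕ (combine i j)          ≡⟨ cong +_ (FinP.toℕ-combine i j) ⟩
    + (n * toℕ i + toℕ j)        ≡⟨ ℤP.pos-+ (n * toℕ i) (toℕ j) ⟩
    + (n * toℕ i) ℤ.+ rep j      ≡⟨ cong (ℤ._+ rep j) (ℤP.pos-* n (toℕ i)) ⟩
    + n ℤ.* rep i ℤ.+ rep j      ∎
    where open ≡-Reasoning

  rep-combine-≡-mod : ∀ {m n} (i : Fin m) (j : Fin n) → rep (combine i j) ≡ rep j mod n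
  rep-combine-≡-mod {n = n} i j =
    ≡-mod (divides (rep i) (trans (cong (ℤ._- rep j) (rep-combine i j)) (cancel (+ n) (rep i) (rep j))))
    where
    cancel : ∀ n i j → n ℤ.* i ℤ.+ j ℤ.- j ≡ i ℤ.* n
    cancel = ℤRing.solve-∀

  -- Sums of periodic functions

  Periodic : ℕ → (ℤ → ℕ) → Set
  Periodic N g = ∀ {x y} → x ≡ y mod N → g x ≡ g y

  ∑-affine : ∀ N .{{_ : NonZero N}} a b → Coprime ∣ a ∣ N → ∀ {g} → Periodic N g →
             ∑[ y < N ] g (a ℤ.* rep y ℤ.+ b) ≡ ∑[ y < N ] g (rep y)
  ∑-affine N a b a⊥N {g} g-periodic =
    trans (sum-cong-≗ (λ y → g-periodic (≡-mod-residue N (f y)))) (∑-injective (g ∘ rep) σ σ-injective)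
    where
    f : Fin N → ℤ
    f y = a ℤ.* rep y ℤ.+ b
    σ : Fin N → Fin N
    σ y = residue N (f y)
    drop-b : ∀ a x y b → (a ℤ.* x ℤ.+ b) ℤ.- (a ℤ.* y ℤ.+ b) ≡ a ℤ.* x ℤ.- a ℤ.* y
    drop-b = ℤRing.solve-∀
    σ-injective : Injective _≡_ _≡_ σ
    σ-injective {i} {j} σi≡σj = rep-≡-mod⇒≡ (≡-mod-cancel-*ˡ {a = a} a⊥N ai≡aj)
      where
      fi≡fj : f i ≡ f j mod N
      fi≡fj = ≡-mod-trans (≡-mod-residue N (f i))
                (subst (_≡ f j mod N) (cong rep (sym σi≡σj)) (≡-mod-sym (≡-mod-residue N (f j))))
      ai≡aj : a ℤ.* rep i ≡ a ℤ.* rep j mod N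
      ai≡aj = ≡-mod (subst (_ ∣_) (drop-b a (rep i) (rep j) b) (∣-difference fi≡fj))

  ∑-translate : ∀ N .{{_ : NonZero N}} {g} → Periodic N g → ∀ b →
                ∑[ y < N ] g (rep y ℤ.- b) ≡ ∑[ y < N ] g (rep y)
  ∑-translate N {g} g-periodic b =
    trans (sum-cong-≗ {N} (λ y → cong (λ x → g (x ℤ.- b)) (sym (ℤP.*-identityˡ (rep y)))))
          (∑-affine N (+ 1) (ℤ.- b) (C.1-coprimeTo N) g-periodic)

  ∑-reflect : ∀ N .{{_ : NonZero N}} {g} → Periodic N g → ∀ b →
              ∑[ y < N ] g (b ℤ.- rep y) ≡ ∑[ y < N ] g (rep y)
  ∑-reflect N {g} g-periodic b =
    trans (sum-cong-≗ {N} (λ y → cong g (negate b (rep y))))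
          (∑-affine N -[1+ 0 ] b (C.1-coprimeTo N) g-periodic)
    where
    negate : ∀ b x → b ℤ.- x ≡ ℤ.- ℤ.+ 1 ℤ.* x ℤ.+ b
    negate = ℤRing.solve-∀

  ∑-periodic : ∀ m n {g} → Periodic n g → ∑[ x < m * n ] g (rep x) ≡ m * ∑[ j < n ] g (rep j)
  ∑-periodic m n {g} g-periodic = begin
    ∑[ x < m * n ] g (rep x)                    ≡⟨ ∑-combine m n (g ∘ rep) ⟩
    ∑[ i < m ] ∑[ j < n ] g (rep (combine i j)) ≡⟨ ∑∑-cong m n (λ i j → g-periodic (rep-combine-≡-mod i j)) ⟩
    ∑[ i < m ] ∑[ j < n ] g (rep j)             ≡⟨ ∑-const m _ ⟩
    m * ∑[ j < n ] g (rep j)                    ∎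
    where open ≡-Reasoning

  -- Writing x = n₂ i + j, the first factor sees i ↦ n₂ i + j, a permutation of ℤ_n₁.
  ∑-crt : ∀ n₁ n₂ .{{_ : NonZero n₁}} → Coprime n₁ n₂ → ∀ {g₁ g₂} → Periodic n₁ g₁ → Periodic n₂ g₂ →
          ∑[ x < n₁ * n₂ ] (g₁ (rep x) * g₂ (rep x)) ≡ (∑[ i < n₁ ] g₁ (rep i)) * (∑[ j < n₂ ] g₂ (rep j))
  ∑-crt n₁ n₂ n₁⊥n₂ {g₁} {g₂} g₁-periodic g₂-periodic = begin
    ∑[ x < n₁ * n₂ ] (g₁ (rep x) * g₂ (rep x))
      ≡⟨ ∑-combine n₁ n₂ _ ⟩
    ∑[ i < n₁ ] ∑[ j < n₂ ] (g₁ (rep (combine i j)) * g₂ (rep (combine i j)))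
      ≡⟨ ∑∑-cong n₁ n₂ (λ i j → cong₂ _*_ (cong g₁ (rep-combine i j)) (g₂-periodic (rep-combine-≡-mod i j))) ⟩
    ∑[ i < n₁ ] ∑[ j < n₂ ] (g₁ (+ n₂ ℤ.* rep i ℤ.+ rep j) * g₂ (rep j))
      ≡⟨ ∑-comm {n₁} {n₂} (λ i j → g₁ (+ n₂ ℤ.* rep i ℤ.+ rep j) * g₂ (rep j)) ⟩
    ∑[ j < n₂ ] ∑[ i < n₁ ] (g₁ (+ n₂ ℤ.* rep i ℤ.+ rep j) * g₂ (rep j))
      ≡⟨ sum-cong-≗ {n₂} (λ j → sym (*-distribʳ-sum {n₁} (g₂ (rep j)) (λ i → g₁ (+ n₂ ℤ.* rep i ℤ.+ rep j)))) ⟩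
    ∑[ j < n₂ ] ((∑[ i < n₁ ] g₁ (+ n₂ ℤ.* rep i ℤ.+ rep j)) * g₂ (rep j))
      ≡⟨ sum-cong-≗ {n₂} (λ j → cong (_* g₂ (rep j)) (∑-affine n₁ (+ n₂) (rep j) (C.sym n₁⊥n₂) g₁-periodic)) ⟩
    ∑[ j < n₂ ] ((∑[ i < n₁ ] g₁ (rep i)) * g₂ (rep j))
      ≡⟨ sym (*-distribˡ-sum {n₂} (∑[ i < n₁ ] g₁ (rep i)) (g₂ ∘ rep)) ⟩
    (∑[ i < n₁ ] g₁ (rep i)) * (∑[ j < n₂ ] g₂ (rep j)) ∎
    where open ≡-Reasoning

  ∑-select : ∀ N .{{_ : NonZero N}} {g} → Periodic N g → ∀ m →
             ∑[ y < N ] (g (rep y) * 𝟙 (+ N ∣? m ℤ.- rep y)) ≡ g m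
  ∑-select N {g} g-periodic m = begin
    ∑[ y < N ] (g (rep y) * 𝟙 (+ N ∣? m ℤ.- rep y))
      ≡⟨ ∑-single N _ r off-r ⟩
    g (rep r) * 𝟙 (+ N ∣? m ℤ.- rep r)
      ≡⟨ cong₂ _*_ (g-periodic (≡-mod-sym m≡r)) (𝟙-yes (+ N ∣? m ℤ.- rep r) (∣-difference m≡r)) ⟩
    g m * 1
      ≡⟨ ℕP.*-identityʳ (g m) ⟩
    g m ∎
    where
    open ≡-Reasoning
    r : Fin N
    r = residue N m
    m≡r : m ≡ rep r mod N
    m≡r = ≡-mod-residue N m
    off-r : ∀ y → y ≢ r → g (rep y) * 𝟙 (+ N ∣? m ℤ.- rep y) ≡ 0
    off-r y y≢r = trans (cong (g (rep y) *_) (𝟙-no (+ N ∣? m ℤ.- rep y) m≢y)) (ℕP.*-zeroʳ (g (rep y)))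
      where
      m≢y : ¬ (+ N ∣ m ℤ.- rep y)
      m≢y N∣m-y = y≢r (rep-≡-mod⇒≡ (≡-mod-trans (≡-mod-sym (≡-mod N∣m-y)) m≡r))

  -- Unit k-tuples with prescribed sum

  unit? : ∀ N z → Dec (Coprime ∣ z ∣ N)
  unit? N z = coprime? ∣ z ∣ N

  firstEntry : ℕ → (ℤ → ℕ) → ℤ → ℤ → ℕ
  firstEntry N g m z = 𝟙 (unit? N z) * g (m ℤ.- z)

  -- unitSolutions N k m is the number of k-tuples of units of ℤ_N with sum ≡ m (mod N),
  -- i.e. 𝒩_{k,f,m}(N) for f(x) = x, counted by the value of the first entry.
  unitSolutions : ℕ → ℕ → ℤ → ℕ
  unitSolutions N zero    m = 𝟙 (+ N ∣? m)
  unitSolutions N (suc k) m = ∑[ y < N ] firstEntry N (unitSolutions N k) m (rep y)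

  unit?-periodic : ∀ N → Periodic N (λ z → 𝟙 (unit? N z))
  unit?-periodic N {x} {y} x≡y =
    𝟙-cong (mk⇔ (coprime-resp-≡-mod x≡y) (coprime-resp-≡-mod (≡-mod-sym x≡y))) (unit? N x) (unit? N y)

  firstEntry-periodic : ∀ {N g} → Periodic N g → ∀ m → Periodic N (firstEntry N g m)
  firstEntry-periodic {N} g-periodic m x≡y =
    cong₂ _*_ (unit?-periodic N x≡y) (g-periodic (≡-mod-reflect m x≡y))

  unitSolutions-periodic : ∀ N k → Periodic N (unitSolutions N k)
  unitSolutions-periodic N zero {x} {y} x≡y =
    𝟙-cong (mk⇔ (∣-resp-≡-mod x≡y) (∣-resp-≡-mod (≡-mod-sym x≡y))) (+ N ∣? x) (+ N ∣? y)
  unitSolutions-periodic N (suc k) x≡y = sum-cong-≗ {N} (λ y →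
    cong (𝟙 (unit? N (rep y)) *_) (unitSolutions-periodic N k (≡-mod-+ʳ (ℤ.- rep y) x≡y)))

  unitSolutions-one-entry : ∀ N .{{_ : NonZero N}} m → unitSolutions N 1 m ≡ 𝟙 (unit? N m)
  unitSolutions-one-entry N m = ∑-select N (unit?-periodic N) m

  unitSolutions-modulus-one : ∀ k m → unitSolutions 1 k m ≡ 1
  unitSolutions-modulus-one zero    m = 𝟙-yes (+ 1 ∣? m) (divides m (sym (ℤP.*-identityʳ m)))
  unitSolutions-modulus-one (suc k) m = cong (λ u → 1 * u + 0) (unitSolutions-modulus-one k (m ℤ.- + 0))

  totient : ℕ → ℕ
  totient N = ∑[ y < N ] 𝟙 (unit? N (rep y))

  ∑-unitSolutions : ∀ N .{{_ : NonZero N}} k → ∑[ m < N ] unitSolutions N k (rep m) ≡ totient N ^ k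
  ∑-unitSolutions (suc N) zero =
    trans (∑-single (suc N) (λ i → 𝟙 (+ suc N ∣? rep i)) zero
                    (λ i i≢0 → 𝟙-no (+ suc N ∣? rep i) (i≢0 ∘ N∣i⇒i≡0)))
          (𝟙-yes (+ suc N ∣? + 0) (divides (+ 0) refl))
    where
    N∣i⇒i≡0 : ∀ {i : Fin (suc N)} → + suc N ∣ rep i → i ≡ zero
    N∣i⇒i≡0 {i} N∣i = rep-≡-mod⇒≡ (≡-mod (subst (+ suc N ∣_) (sym (ℤP.+-identityʳ (rep i))) N∣i))
  ∑-unitSolutions N (suc k) = begin
    ∑[ m < N ] ∑[ y < N ] (u y * U (rep m ℤ.- rep y))
      ≡⟨ ∑-comm {N} {N} (λ m y → u y * U (rep m ℤ.- rep y)) ⟩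
    ∑[ y < N ] ∑[ m < N ] (u y * U (rep m ℤ.- rep y))
      ≡⟨ sum-cong-≗ {N} (λ y → sym (*-distribˡ-sum {N} (u y) (λ m → U (rep m ℤ.- rep y)))) ⟩
    ∑[ y < N ] (u y * ∑[ m < N ] U (rep m ℤ.- rep y))
      ≡⟨ sum-cong-≗ {N} (λ y → cong (u y *_) (∑-translate N (unitSolutions-periodic N k) (rep y))) ⟩
    ∑[ y < N ] (u y * ∑[ m < N ] U (rep m))
      ≡⟨ sym (*-distribʳ-sum {N} (∑[ m < N ] U (rep m)) u) ⟩
    totient N * ∑[ m < N ] U (rep m)
      ≡⟨ cong (totient N *_) (∑-unitSolutions N k) ⟩
    totient N * totient N ^ k ∎
    where
    open ≡-Reasoning
    u : Fin N → ℕ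
    u y = 𝟙 (unit? N (rep y))
    U : ℤ → ℕ
    U = unitSolutions N k

  unitSolutions-* : ∀ n₁ n₂ .{{_ : NonZero n₁}} → Coprime n₁ n₂ → ∀ k m →
                    unitSolutions (n₁ * n₂) k m ≡ unitSolutions n₁ k m * unitSolutions n₂ k m
  unitSolutions-* n₁ n₂ n₁⊥n₂ zero m =
    trans (𝟙-cong (*-∣⇔ n₁⊥n₂) (+ (n₁ * n₂) ∣? m) ((+ n₁ ∣? m) ×-dec (+ n₂ ∣? m)))
          (𝟙-×-dec (+ n₁ ∣? m) (+ n₂ ∣? m))
  unitSolutions-* n₁ n₂ n₁⊥n₂ (suc k) m =
    trans (sum-cong-≗ {n₁ * n₂} (λ y → split (rep y)))
          (∑-crt n₁ n₂ n₁⊥n₂ (firstEntry-periodic (unitSolutions-periodic n₁ k) m)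
                             (firstEntry-periodic (unitSolutions-periodic n₂ k) m))
    where
    split : ∀ z → firstEntry (n₁ * n₂) (unitSolutions (n₁ * n₂) k) m z ≡
                  firstEntry n₁ (unitSolutions n₁ k) m z * firstEntry n₂ (unitSolutions n₂ k) m z
    split z = begin
      𝟙 (unit? (n₁ * n₂) z) * unitSolutions (n₁ * n₂) k (m ℤ.- z)
        ≡⟨ cong₂ _*_ (trans (𝟙-cong coprime-*⇔ (unit? (n₁ * n₂) z) (unit? n₁ z ×-dec unit? n₂ z))
                            (𝟙-×-dec (unit? n₁ z) (unit? n₂ z)))
                     (unitSolutions-* n₁ n₂ n₁⊥n₂ k (m ℤ.- z)) ⟩
      (u₁ * u₂) * (U₁ * U₂)
        ≡⟨ ℕP.[m*n]*[o*p]≡[m*o]*[n*p] u₁ u₂ U₁ U₂ ⟩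
      (u₁ * U₁) * (u₂ * U₂) ∎
      where
      open ≡-Reasoning
      u₁ u₂ U₁ U₂ : ℕ
      u₁ = 𝟙 (unit? n₁ z)
      u₂ = 𝟙 (unit? n₂ z)
      U₁ = unitSolutions n₁ k (m ℤ.- z)
      U₂ = unitSolutions n₂ k (m ℤ.- z)

  unitSolutions-∣ : ∀ p q .{{_ : NonZero p}} .{{_ : NonZero q}} → p ∣ℕ q → ∀ k m →
                    unitSolutions (p * q) (suc k) m ≡ p ^ k * unitSolutions q (suc k) m
  unitSolutions-∣ p q p∣q zero m = begin
    unitSolutions (p * q) 1 m    ≡⟨ unitSolutions-one-entry (p * q) m ⟩
    𝟙 (unit? (p * q) m)          ≡⟨ 𝟙-cong (coprime-*-∣⇔ p∣q) (unit? (p * q) m) (unit? q m) ⟩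
    𝟙 (unit? q m)                ≡⟨ unitSolutions-one-entry q m ⟨
    unitSolutions q 1 m          ≡⟨ ℕP.*-identityˡ _ ⟨
    1 * unitSolutions q 1 m      ∎
    where
    open ≡-Reasoning
    instance _ = ℕP.m*n≢0 p q
  unitSolutions-∣ p q p∣q (suc k) m = begin
    ∑[ y < p * q ] firstEntry (p * q) (unitSolutions (p * q) (suc k)) m (rep y)
      ≡⟨ sum-cong-≗ {p * q} (λ y → pull-out (rep y)) ⟩
    ∑[ y < p * q ] (p ^ k * firstEntry q U m (rep y))
      ≡⟨ *-distribˡ-sum {p * q} (p ^ k) (λ y → firstEntry q U m (rep y)) ⟨
    p ^ k * ∑[ y < p * q ] firstEntry q U m (rep y)
      ≡⟨ cong (p ^ k *_) (∑-periodic p q (firstEntry-periodic (unitSolutions-periodic q (suc k)) m)) ⟩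
    p ^ k * (p * unitSolutions q (suc (suc k)) m)
      ≡⟨ x∙yz≈yx∙z (p ^ k) p _ ⟩
    p ^ suc k * unitSolutions q (suc (suc k)) m ∎
    where
    open ≡-Reasoning
    U : ℤ → ℕ
    U = unitSolutions q (suc k)
    pull-out : ∀ z → firstEntry (p * q) (unitSolutions (p * q) (suc k)) m z ≡ p ^ k * firstEntry q U m z
    pull-out z = begin
      𝟙 (unit? (p * q) z) * unitSolutions (p * q) (suc k) (m ℤ.- z)
        ≡⟨ cong₂ _*_ (𝟙-cong (coprime-*-∣⇔ p∣q) (unit? (p * q) z) (unit? q z))
                     (unitSolutions-∣ p q p∣q k (m ℤ.- z)) ⟩
      𝟙 (unit? q z) * (p ^ k * U (m ℤ.- z))
        ≡⟨ x∙yz≈y∙xz (𝟙 (unit? q z)) (p ^ k) _ ⟩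
      p ^ k * (𝟙 (unit? q z) * U (m ℤ.- z)) ∎

  -- Prime moduli

  pos-^ : ∀ m k → + (m ^ k) ≡ (+ m) ℤ.^ k
  pos-^ m zero    = refl
  pos-^ m (suc k) = trans (ℤP.pos-* m (m ^ k)) (cong (ℤ._*_ (+ m)) (pos-^ m k))

  module _ {q : ℕ} (p-prime : Prime (suc q)) where

    𝟙-unit?-0 : 𝟙 (unit? (suc q) (+ 0)) ≡ 0
    𝟙-unit?-0 = 𝟙-no (unit? (suc q) (+ 0)) (C.¬0-coprimeTo-2+ {{prime⇒nonTrivial p-prime}})

    𝟙-unit?-suc : ∀ (i : Fin q) → 𝟙 (unit? (suc q) (rep (suc i))) ≡ 1
    𝟙-unit?-suc i =
      𝟙-yes (unit? (suc q) (rep (suc i))) (C.sym (C.prime⇒coprime p-prime (s≤s (FinP.toℕ<n i))))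

    totient-prime : totient (suc q) ≡ q
    totient-prime =
      cong₂ _+_ 𝟙-unit?-0 (trans (sum-cong-≗ {q} 𝟙-unit?-suc) (trans (∑-const q 1) (ℕP.*-identityʳ q)))

    -- Only the term y = 0 is not a unit, so adding U (m - 0) completes the sum over all of ℤ_p.
    unitSolutions-prime-step : ∀ k m → unitSolutions (suc q) (suc k) m + unitSolutions (suc q) k m ≡ q ^ k
    unitSolutions-prime-step k m = begin
      unitSolutions (suc q) (suc k) m + U m
        ≡⟨ cong₂ _+_ (cong₂ _+_ (cong (_* U (m ℤ.- + 0)) 𝟙-unit?-0)
                                (sum-cong-≗ {q} (λ i → trans (cong (_* U (m ℤ.- rep (suc i))) (𝟙-unit?-suc i))
                                                            (ℕP.*-identityˡ _))))
                     (cong U (sym (ℤP.+-identityʳ m))) ⟩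
      ∑[ i < q ] U (m ℤ.- rep (suc i)) + U (m ℤ.- + 0)
        ≡⟨ ℕP.+-comm (∑[ i < q ] U (m ℤ.- rep (suc i))) _ ⟩
      ∑[ y < suc q ] U (m ℤ.- rep y)
        ≡⟨ ∑-reflect (suc q) (unitSolutions-periodic (suc q) k) m ⟩
      ∑[ y < suc q ] U (rep y)
        ≡⟨ ∑-unitSolutions (suc q) k ⟩
      totient (suc q) ^ k
        ≡⟨ cong (_^ k) totient-prime ⟩
      q ^ k ∎
      where
      open ≡-Reasoning
      U : ℤ → ℕ
      U = unitSolutions (suc q) k

    -- The hypothesis on d says that d = δ_p: p - 1 if p ∣ m, and -1 otherwise.
    unitSolutions-prime : ∀ m {d} → + suc q ℤ.* + 𝟙 (+ suc q ∣? m) ≡ + 1 ℤ.+ d → ∀ k →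
                          + suc q ℤ.* + unitSolutions (suc q) k m ≡ (+ q) ℤ.^ k ℤ.+ -[1+ 0 ] ℤ.^ k ℤ.* d
    unitSolutions-prime m {d} base zero    = trans base (cong (ℤ._+_ (+ 1)) (sym (ℤP.*-identityˡ d)))
    unitSolutions-prime m {d} base (suc k) = begin
      + suc q ℤ.* u₁
        ≡⟨ split (+ suc q) u₁ u₀ ⟩
      + suc q ℤ.* (u₁ ℤ.+ u₀) ℤ.- + suc q ℤ.* u₀
        ≡⟨ cong₂ (λ s t → + suc q ℤ.* s ℤ.- t) u₁+u₀≡X (unitSolutions-prime m base k) ⟩
      + suc q ℤ.* X ℤ.- (X ℤ.+ Y ℤ.* d)
        ≡⟨ rearrange (+ q) X Y d ⟩
      + q ℤ.* X ℤ.+ (-[1+ 0 ] ℤ.* Y) ℤ.* d ∎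
      where
      open ≡-Reasoning
      u₀ u₁ X Y : ℤ
      u₀ = + unitSolutions (suc q) k m
      u₁ = + unitSolutions (suc q) (suc k) m
      X = (+ q) ℤ.^ k
      Y = -[1+ 0 ] ℤ.^ k
      u₁+u₀≡X : u₁ ℤ.+ u₀ ≡ X
      u₁+u₀≡X = trans (sym (ℤP.pos-+ (unitSolutions (suc q) (suc k) m) (unitSolutions (suc q) k m)))
                      (trans (cong +_ (unitSolutions-prime-step k m)) (pos-^ q k))
      split : ∀ p u₁ u₀ → p ℤ.* u₁ ≡ p ℤ.* (u₁ ℤ.+ u₀) ℤ.- p ℤ.* u₀
      split = ℤRing.solve-∀
      rearrange : ∀ q X Y d → (ℤ.+ 1 ℤ.+ q) ℤ.* X ℤ.- (X ℤ.+ Y ℤ.* d) ≡ q ℤ.* X ℤ.+ (ℤ.- ℤ.+ 1 ℤ.* Y) ℤ.* d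
      rearrange = ℤRing.solve-∀

  -- Exunit k-tuples

  module _ {A B : Set} {P : B → Set} (P? : Decidable P) (h : A → B) where

    length-filter-map-⇔ : ∀ {Q : A → Set} (Q? : Decidable Q) → (∀ v → P (h v) ⇔ Q v) →
                          ∀ vs → length (filter P? (map h vs)) ≡ length (filter Q? vs)
    length-filter-map-⇔ Q? P⇔Q [] = refl
    length-filter-map-⇔ Q? P⇔Q (v ∷ vs) with P? (h v) | Q? v
    ... | yes _ | yes _ = cong suc (length-filter-map-⇔ Q? P⇔Q vs)
    ... | no _  | no _  = length-filter-map-⇔ Q? P⇔Q vs
    ... | yes p | no ¬q = ⊥-elim (¬q (Equivalence.to (P⇔Q v) p))
    ... | no ¬p | yes q = ⊥-elim (¬p (Equivalence.from (P⇔Q v) q))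

    length-filter-map-∅ : (∀ v → ¬ P (h v)) → ∀ vs → length (filter P? (map h vs)) ≡ 0
    length-filter-map-∅ ¬P [] = refl
    length-filter-map-∅ ¬P (v ∷ vs) with P? (h v)
    ... | yes p = ⊥-elim (¬P v p)
    ... | no _  = length-filter-map-∅ ¬P vs

  length-filter-concatMap-tabulate :
    ∀ {A B : Set} {P : B → Set} (P? : Decidable P) (h : A → List B) n (g : Fin n → A) →
    length (filter P? (concatMap h (tabulate g))) ≡ ∑[ i < n ] length (filter P? (h (g i)))
  length-filter-concatMap-tabulate P? h zero    g = refl
  length-filter-concatMap-tabulate P? h (suc n) g = begin
    length (filter P? (h (g zero) ++ concatMap h (tabulate (g ∘ suc))))
      ≡⟨ cong length (ListP.filter-++ P? (h (g zero)) _) ⟩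
    length (filter P? (h (g zero)) ++ filter P? (concatMap h (tabulate (g ∘ suc))))
      ≡⟨ ListP.length-++ (filter P? (h (g zero))) ⟩
    length (filter P? (h (g zero))) + length (filter P? (concatMap h (tabulate (g ∘ suc))))
      ≡⟨ cong (_+_ (length (filter P? (h (g zero))))) (length-filter-concatMap-tabulate P? h n (g ∘ suc)) ⟩
    length (filter P? (h (g zero))) + ∑[ i < n ] length (filter P? (h (g (suc i)))) ∎
    where open ≡-Reasoning

  gcd≡1⇔coprime : ∀ x n → gcd x (+ n) ≡ + 1 ⇔ Coprime ∣ x ∣ n
  gcd≡1⇔coprime x n = mk⇔ (C.gcd≡1⇒coprime ∘ ℤP.+-injective) (cong +_ ∘ C.coprime⇒gcd≡1)

  module _ (a b : ℤ) (n : ℕ) where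

    𝒩-zero : ∀ c → 𝒩 0 a b c n ≡ 𝟙 (+ n ∣? + 0 ℤ.- c)
    𝒩-zero c with does (+ n ∣? + 0 ℤ.- c)
    ... | true  = refl
    ... | false = refl

    𝒩-suc : ∀ k c → 𝒩 (suc k) a b c n ≡ ∑[ x < n ] (𝟙 (isExunit? a b n x) * 𝒩 k a b (c ℤ.- rep x) n)
    𝒩-suc k c =
      trans (length-filter-concatMap-tabulate (good? a b c n (suc k)) (λ x → map (x ∷_) (allVecs n k)) n id)
            (sum-cong-≗ {n} first)
      where
      first : ∀ x → length (filter (good? a b c n (suc k)) (map (x ∷_) (allVecs n k))) ≡
                    𝟙 (isExunit? a b n x) * 𝒩 k a b (c ℤ.- rep x) n
      first x = by-cases (isExunit? a b n x)
        where
        shift : ∀ x s c → x ℤ.+ s ℤ.- c ≡ s ℤ.- (c ℤ.- x)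
        shift = ℤRing.solve-∀
        rest⇔ : IsExunit a b n x → ∀ v → Good a b c n (suc k) (x ∷ v) ⇔ Good a b (c ℤ.- rep x) n k v
        rest⇔ ex v = mk⇔ (λ ((_ , all) , n∣) → all , subst (_ ∣_) (shift (rep x) (vsum v) c) n∣)
                         (λ (all , n∣) → (ex , all) , subst (_ ∣_) (sym (shift (rep x) (vsum v) c)) n∣)
        by-cases : (ex? : Dec (IsExunit a b n x)) →
                   length (filter (good? a b c n (suc k)) (map (x ∷_) (allVecs n k))) ≡
                   𝟙 ex? * 𝒩 k a b (c ℤ.- rep x) n
        by-cases (no ¬ex) =
          length-filter-map-∅ (good? a b c n (suc k)) (x ∷_) (λ _ good → ¬ex (proj₁ (proj₁ good)))
                              (allVecs n k)
        by-cases (yes ex) =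
          trans (length-filter-map-⇔ (good? a b c n (suc k)) (x ∷_) (good? a b (c ℤ.- rep x) n k) (rest⇔ ex)
                                     (allVecs n k))
                (sym (ℕP.+-identityʳ _))

  𝒩≡unitSolutions : ∀ a b n .{{_ : NonZero n}} → Coprime ∣ a ∣ n → ∀ k c →
                    𝒩 k a b c n ≡ unitSolutions n k (a ℤ.* c ℤ.+ + k ℤ.* b)
  𝒩≡unitSolutions a b n a⊥n zero c =
    trans (𝒩-zero a b n c) (𝟙-cong (mk⇔ to from) (+ n ∣? + 0 ℤ.- c) (+ n ∣? a ℤ.* c ℤ.+ + 0 ℤ.* b))
    where
    scale : ∀ a b c → ℤ.- (a ℤ.* (+ 0 ℤ.- c)) ≡ a ℤ.* c ℤ.+ + 0 ℤ.* b
    scale = ℤRing.solve-∀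
    drop-b : ∀ a b c → a ℤ.* c ℤ.+ + 0 ℤ.* b ≡ a ℤ.* c
    drop-b = ℤRing.solve-∀
    negate : ∀ c → ℤ.- c ≡ + 0 ℤ.- c
    negate = ℤRing.solve-∀
    to : + n ∣ + 0 ℤ.- c → + n ∣ a ℤ.* c ℤ.+ + 0 ℤ.* b
    to n∣-c = subst (_ ∣_) (scale a b c) (ℤD.∣m⇒∣-m (ℤD.∣n⇒∣m*n a n∣-c))
    from : + n ∣ a ℤ.* c ℤ.+ + 0 ℤ.* b → + n ∣ + 0 ℤ.- c
    from n∣ac = subst (_ ∣_) (negate c) (ℤD.∣m⇒∣-m (∣ᵤ⇒∣ (ℤCoprime.coprime-divisor (+ n) a c (C.sym a⊥n)
                                                         (∣⇒∣ᵤ (subst (_ ∣_) (drop-b a b c) n∣ac)))))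
  𝒩≡unitSolutions a b n a⊥n (suc k) c = begin
    𝒩 (suc k) a b c n
      ≡⟨ 𝒩-suc a b n k c ⟩
    ∑[ x < n ] (𝟙 (isExunit? a b n x) * 𝒩 k a b (c ℤ.- rep x) n)
      ≡⟨ sum-cong-≗ {n} (λ x → cong₂ _*_ (exunit≡unit x) (rest x)) ⟩
    ∑[ x < n ] firstEntry n (unitSolutions n k) M (a ℤ.* rep x ℤ.+ b)
      ≡⟨ ∑-affine n a b a⊥n (firstEntry-periodic (unitSolutions-periodic n k) M) ⟩
    unitSolutions n (suc k) M ∎
    where
    open ≡-Reasoning
    M : ℤ
    M = a ℤ.* c ℤ.+ + suc k ℤ.* b
    shift : ∀ a b c x k → a ℤ.* (c ℤ.- x) ℤ.+ k ℤ.* b ≡ (a ℤ.* c ℤ.+ (ℤ.+ 1 ℤ.+ k) ℤ.* b) ℤ.- (a ℤ.* x ℤ.+ b)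
    shift = ℤRing.solve-∀
    rest : ∀ x → 𝒩 k a b (c ℤ.- rep x) n ≡ unitSolutions n k (M ℤ.- (a ℤ.* rep x ℤ.+ b))
    rest x = trans (𝒩≡unitSolutions a b n a⊥n k (c ℤ.- rep x))
                   (cong (unitSolutions n k) (shift a b c (rep x) (+ k)))
    exunit≡unit : ∀ x → 𝟙 (isExunit? a b n x) ≡ 𝟙 (unit? n (a ℤ.* rep x ℤ.+ b))
    exunit≡unit x =
      𝟙-cong (gcd≡1⇔coprime (a ℤ.* rep x ℤ.+ b) n) (isExunit? a b n x) (unit? n (a ℤ.* rep x ℤ.+ b))

  fromℕ : ℕ → ℚ
  fromℕ x = + x / 1

  fromℚᵘ-* : ∀ p q → fromℚᵘ (p ℚᵘ.* q) ≡ fromℚᵘ p ℚ.* fromℚᵘ q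
  fromℚᵘ-* p q = ℚP.toℚᵘ-injective (ℚᵘP.≃-trans (ℚP.toℚᵘ-fromℚᵘ (p ℚᵘ.* q))
    (ℚᵘP.≃-trans (ℚᵘP.*-cong (ℚᵘP.≃-sym (ℚP.toℚᵘ-fromℚᵘ p)) (ℚᵘP.≃-sym (ℚP.toℚᵘ-fromℚᵘ q)))
                 (ℚᵘP.≃-sym (ℚP.toℚᵘ-homo-* (fromℚᵘ p) (fromℚᵘ q)))))

  -- i / suc m computes to fromℚᵘ (mkℚᵘ i m), so both lemmas are statements about ℚᵘ.
  *≡*⇒/≡ : ∀ i j m n .{{_ : NonZero m}} .{{_ : NonZero n}} → i ℤ.* + n ≡ j ℤ.* + m → i / m ≡ j / n
  *≡*⇒/≡ i j (suc m) (suc n) eq = ℚP.fromℚᵘ-cong {ℚᵘ.mkℚᵘ i m} {ℚᵘ.mkℚᵘ j n} (ℚᵘ.*≡* eq)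

  /-*-/ : ∀ i j m n .{{_ : NonZero m}} .{{_ : NonZero n}} →
          (i / m) ℚ.* (j / n) ≡ _/_ (i ℤ.* j) (m * n) {{ℕP.m*n≢0 m n}}
  /-*-/ i j (suc m) (suc n) = sym (fromℚᵘ-* (ℚᵘ.mkℚᵘ i m) (ℚᵘ.mkℚᵘ j n))

  fromℕ-* : ∀ x y → fromℕ (x * y) ≡ fromℕ x ℚ.* fromℕ y
  fromℕ-* x y = trans (cong (_/ 1) (ℤP.pos-* x y)) (sym (/-*-/ (+ x) (+ y) 1 1))

  fromℕ≡*/ : ∀ u A X D .{{_ : NonZero D}} → + u ℤ.* + D ≡ + A ℤ.* X → fromℕ u ≡ fromℕ A ℚ.* (X / D)
  fromℕ≡*/ u A X D eq =
    trans (*≡*⇒/≡ (+ u) (+ A ℤ.* X) 1 (1 * D) {{_}} {{ℕP.m*n≢0 1 D}} cross) (sym (/-*-/ (+ A) X 1 D))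
    where
    cross : + u ℤ.* + (1 * D) ≡ + A ℤ.* X ℤ.* + 1
    cross = trans (cong (λ d → + u ℤ.* + d) (ℕP.*-identityˡ D)) (trans eq (sym (ℤP.*-identityʳ _)))

  ^-distribʳ-* : ∀ m n k → (m * n) ^ k ≡ m ^ k * n ^ k
  ^-distribʳ-* m n zero    = refl
  ^-distribʳ-* m n (suc k) =
    trans (cong (m * n *_) (^-distribʳ-* m n k)) (ℕP.[m*n]*[o*p]≡[m*o]*[n*p] m n (m ^ k) (n ^ k))

  fromℕ-^-* : ∀ m n k → fromℕ ((m * n) ^ k) ≡ fromℕ (m ^ k) ℚ.* fromℕ (n ^ k)
  fromℕ-^-* m n k = trans (cong fromℕ (^-distribʳ-* m n k)) (fromℕ-* (m ^ k) (n ^ k))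

  ∏< : ℕ → (ℕ → ℚ) → ℚ
  ∏< zero    f = 1ℚ
  ∏< (suc N) f = f 0 ℚ.* ∏< N (f ∘ suc)

  syntax ∏< N (λ i → e) = ∏[ i < N ] e

  ∏-cong : ∀ N {f g} → (∀ i → i < N → f i ≡ g i) → ∏< N f ≡ ∏< N g
  ∏-cong zero    f≡g = refl
  ∏-cong (suc N) f≡g = cong₂ ℚ._*_ (f≡g 0 ℕ.z<s) (∏-cong N (λ i i<N → f≡g (suc i) (ℕ.s<s i<N)))

  ∏-ones : ∀ N f → (∀ i → i < N → f i ≡ 1ℚ) → ∏< N f ≡ 1ℚ
  ∏-ones N f f≡1 = trans (∏-cong N f≡1) (ones N)
    where
    ones : ∀ N → ∏[ i < N ] 1ℚ ≡ 1ℚ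
    ones zero    = refl
    ones (suc N) = trans (ℚP.*-identityˡ _) (ones N)

  ∏-* : ∀ N f g → ∏[ i < N ] (f i ℚ.* g i) ≡ ∏< N f ℚ.* ∏< N g
  ∏-* zero    f g = sym (ℚP.*-identityˡ 1ℚ)
  ∏-* (suc N) f g =
    trans (cong (ℚ._*_ (f 0 ℚ.* g 0)) (∏-* N (f ∘ suc) (g ∘ suc))) (ℚ-interchange (f 0) (g 0) _ _)

  ∏-single : ∀ N f r → r < N → (∀ i → i < N → i ≢ r → f i ≡ 1ℚ) → ∏< N f ≡ f r
  ∏-single (suc N) f zero    _   f≡1 =
    trans (cong (ℚ._*_ (f 0)) (∏-ones N (f ∘ suc) (λ i i<N → f≡1 (suc i) (ℕ.s<s i<N) λ ())))
          (ℚP.*-identityʳ (f 0))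
  ∏-single (suc N) f (suc r) r<N f≡1 =
    trans (cong (ℚ._* ∏< N (f ∘ suc)) (f≡1 0 ℕ.z<s λ ()))
          (trans (ℚP.*-identityˡ _) (∏-single N (f ∘ suc) r (ℕ.s<s⁻¹ r<N) off-r))
    where
    off-r : ∀ i → i < N → i ≢ r → f (suc i) ≡ 1ℚ
    off-r i i<N i≢r = f≡1 (suc i) (ℕ.s<s i<N) (i≢r ∘ ℕP.suc-injective)

  ∏-+ : ∀ M K f → ∏< (M + K) f ≡ ∏< M f ℚ.* ∏[ i < K ] f (M + i)
  ∏-+ zero    K f = sym (ℚP.*-identityˡ _)
  ∏-+ (suc M) K f = trans (cong (ℚ._*_ (f 0)) (∏-+ M K (f ∘ suc))) (sym (ℚP.*-assoc (f 0) _ _))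

  ∏-≤ : ∀ M N f → M ≤ N → (∀ i → M ≤ i → i < N → f i ≡ 1ℚ) → ∏< N f ≡ ∏< M f
  ∏-≤ M N f M≤N f≡1 = begin
    ∏< N f                              ≡⟨ cong (λ n → ∏< n f) (ℕP.m+[n∸m]≡n M≤N) ⟨
    ∏< (M + (N ∸ M)) f                  ≡⟨ ∏-+ M (N ∸ M) f ⟩
    ∏< M f ℚ.* ∏[ i < N ∸ M ] f (M + i) ≡⟨ cong (ℚ._*_ (∏< M f)) (∏-ones (N ∸ M) _ beyond) ⟩
    ∏< M f ℚ.* 1ℚ                       ≡⟨ ℚP.*-identityʳ _ ⟩
    ∏< M f                              ∎
    where
    open ≡-Reasoning
    beyond : ∀ i → i < N ∸ M → f (M + i) ≡ 1ℚ
    beyond i i<N-M = f≡1 (M + i) (ℕP.m≤m+n M i) (subst (M + i <_) (ℕP.m+[n∸m]≡n M≤N) (ℕP.+-monoʳ-< M i<N-M))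

  foldr-*-filter-applyUpTo : ∀ {P : ℕ → Set} (P? : Decidable P) (F : ℕ → ℚ) N g →
    foldr ℚ._*_ 1ℚ (map F (filter P? (applyUpTo g N))) ≡ ∏[ i < N ] (if does (P? (g i)) then F (g i) else 1ℚ)
  foldr-*-filter-applyUpTo P? F zero    g = refl
  foldr-*-filter-applyUpTo P? F (suc N) g with does (P? (g 0))
  ... | true  = cong (ℚ._*_ (F (g 0))) (foldr-*-filter-applyUpTo P? F N (g ∘ suc))
  ... | false = trans (foldr-*-filter-applyUpTo P? F N (g ∘ suc)) (sym (ℚP.*-identityˡ _))

  -- Products over prime divisors

  module _ (F : ℕ → ℚ) where

    primeProduct : ℕ → ℚ
    primeProduct n = foldr ℚ._*_ 1ℚ (map F (primeDivisors n))

    primeWeight : ℕ → ℕ → ℚ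
    primeWeight n i = if does (prime? i ×-dec (i ℕD.∣? n)) then F i else 1ℚ

    primeWeight-cong : ∀ {m n} i → (Prime i → i ∣ℕ m ⇔ i ∣ℕ n) → primeWeight m i ≡ primeWeight n i
    primeWeight-cong {m} {n} i i∣m⇔i∣n =
      cong (λ b → if b then F i else 1ℚ)
           (does-⇔ same (prime? i ×-dec (i ℕD.∣? m)) (prime? i ×-dec (i ℕD.∣? n)))
      where
      same : (Prime i × i ∣ℕ m) ⇔ (Prime i × i ∣ℕ n)
      same = mk⇔ (λ (i-prime , i∣m) → i-prime , Equivalence.to (i∣m⇔i∣n i-prime) i∣m)
                 (λ (i-prime , i∣n) → i-prime , Equivalence.from (i∣m⇔i∣n i-prime) i∣n)

    primeWeight-prime : ∀ {n p} → Prime p → p ∣ℕ n → primeWeight n p ≡ F p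
    primeWeight-prime {n} {p} p-prime p∣n
      rewrite dec-true (prime? p ×-dec (p ℕD.∣? n)) (p-prime , p∣n) = refl

    primeWeight-∤ : ∀ {n i} → ¬ (i ∣ℕ n) → primeWeight n i ≡ 1ℚ
    primeWeight-∤ {n} {i} i∤n rewrite dec-false (prime? i ×-dec (i ℕD.∣? n)) (i∤n ∘ proj₂) = refl

    primeProduct-∏ : ∀ n N → 1 ≤ n → n < N → primeProduct n ≡ ∏< N (primeWeight n)
    primeProduct-∏ n N 1≤n n<N =
      trans (foldr-*-filter-applyUpTo (λ p → prime? p ×-dec (p ℕD.∣? n)) F (suc n) id)
            (sym (∏-≤ (suc n) N (primeWeight n) n<N (λ i n<i _ → primeWeight-∤ (ℕD.>⇒∤ n<i))))
      where instance _ = ℕ.>-nonZero 1≤n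

    module _ {p q} (p-prime : Prime p) (1≤q : 1 ≤ q) where

      private
        instance
          _ = prime⇒nonZero p-prime
          _ = ℕ.>-nonZero 1≤q
        N : ℕ
        N = suc (p * q)
        1≤pq : 1 ≤ p * q
        1≤pq = ℕP.*-mono-≤ (ℕ.>-nonZero⁻¹ p) 1≤q

      primeProduct-∣ : p ∣ℕ q → primeProduct (p * q) ≡ primeProduct q
      primeProduct-∣ p∣q = begin
        primeProduct (p * q)       ≡⟨ primeProduct-∏ (p * q) N 1≤pq (ℕP.n<1+n _) ⟩
        ∏< N (primeWeight (p * q)) ≡⟨ ∏-cong N (λ i _ → primeWeight-cong i same-divisors) ⟩
        ∏< N (primeWeight q)       ≡⟨ primeProduct-∏ q N 1≤q (s≤s (ℕP.m≤n*m q p)) ⟨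
        primeProduct q             ∎
        where
        open ≡-Reasoning
        same-divisors : ∀ {i} → Prime i → i ∣ℕ p * q ⇔ i ∣ℕ q
        same-divisors {i} i-prime = mk⇔ to (λ i∣q → ℕD.∣-trans i∣q (ℕD.n∣m*n p))
          where
          to : i ∣ℕ p * q → i ∣ℕ q
          to i∣pq with euclidsLemma p q i-prime i∣pq
          ... | inj₁ i∣p = subst (_∣ℕ q) (sym (prime-∣-prime p-prime i-prime i∣p)) p∣q
          ... | inj₂ i∣q = i∣q

      primeProduct-∤ : ¬ (p ∣ℕ q) → primeProduct (p * q) ≡ F p ℚ.* primeProduct q
      primeProduct-∤ p∤q = begin
        primeProduct (p * q)                   ≡⟨ primeProduct-∏ (p * q) N 1≤pq (ℕP.n<1+n _) ⟩
        ∏< N (primeWeight (p * q))             ≡⟨ ∏-cong N (λ i _ → split i) ⟩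
        ∏[ i < N ] (atP i ℚ.* primeWeight q i) ≡⟨ ∏-* N atP (primeWeight q) ⟩
        ∏< N atP ℚ.* ∏< N (primeWeight q)      ≡⟨ cong₂ ℚ._*_ (∏-single N atP p p<N (λ i _ → atP-≢))
                                                               (sym (primeProduct-∏ q N 1≤q q<N)) ⟩
        atP p ℚ.* primeProduct q               ≡⟨ cong (ℚ._* primeProduct q) atP-p ⟩
        F p ℚ.* primeProduct q                 ∎
        where
        open ≡-Reasoning
        p<N : p < N
        p<N = s≤s (ℕP.m≤m*n p q)
        q<N : q < N
        q<N = s≤s (ℕP.m≤n*m q p)
        atP : ℕ → ℚ
        atP i = if does (i ℕ.≟ p) then F i else 1ℚ
        atP-p : atP p ≡ F p
        atP-p rewrite dec-true (p ℕ.≟ p) refl = refl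
        atP-≢ : ∀ {i} → i ≢ p → atP i ≡ 1ℚ
        atP-≢ {i} i≢p rewrite dec-false (i ℕ.≟ p) i≢p = refl
        other-divisors : ∀ {i} → i ≢ p → Prime i → i ∣ℕ p * q ⇔ i ∣ℕ q
        other-divisors {i} i≢p i-prime = mk⇔ to (λ i∣q → ℕD.∣-trans i∣q (ℕD.n∣m*n p))
          where
          to : i ∣ℕ p * q → i ∣ℕ q
          to i∣pq with euclidsLemma p q i-prime i∣pq
          ... | inj₁ i∣p = ⊥-elim (i≢p (prime-∣-prime p-prime i-prime i∣p))
          ... | inj₂ i∣q = i∣q
        split : ∀ i → primeWeight (p * q) i ≡ atP i ℚ.* primeWeight q i
        split i with i ℕ.≟ p
        ... | yes refl = trans (primeWeight-prime p-prime (ℕD.m∣m*n q))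
                               (sym (trans (cong₂ ℚ._*_ atP-p (primeWeight-∤ p∤q)) (ℚP.*-identityʳ (F p))))
        ... | no i≢p   = trans (primeWeight-cong i (other-divisors i≢p))
                               (sym (trans (cong (ℚ._* primeWeight q i) (atP-≢ i≢p)) (ℚP.*-identityˡ _)))

  module _ (k : ℕ) (a b c : ℤ) where

    private
      M : ℤ
      M = a ℤ.* c ℤ.+ + suc k ℤ.* b
      F : ℕ → ℚ
      F = factor (suc k) a b c

    p·𝟙[p∣M]≡1+δ : ∀ p → + p ℤ.* + 𝟙 (+ p ∣? M) ≡ + 1 ℤ.+ δ p (suc k) a b c
    p·𝟙[p∣M]≡1+δ p with + p ∣? M
    ... | yes p∣M = trans (cong (λ x → + p ℤ.* + x) (𝟙-yes (+ p ∣? M) p∣M)) (one+ (+ p))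
      where
      one+ : ∀ p → p ℤ.* + 1 ≡ + 1 ℤ.+ (p ℤ.- + 1)
      one+ = ℤRing.solve-∀
    ... | no p∤M  = trans (cong (λ x → + p ℤ.* + x) (𝟙-no (+ p ∣? M) p∤M)) (ℤP.*-zeroʳ (+ p))

    fromℕ-unitSolutions-prime : ∀ {p} → Prime p → fromℕ (unitSolutions p (suc k) M) ≡ fromℕ (p ^ k) ℚ.* F p
    fromℕ-unitSolutions-prime {suc q} p-prime =
      fromℕ≡*/ U (suc q ^ k) X (suc q ^ suc k) {{ℕP.m^n≢0 (suc q) (suc k)}} (begin
        + U ℤ.* (+ (suc q * suc q ^ k))     ≡⟨ cong (ℤ._*_ (+ U)) (ℤP.pos-* (suc q) (suc q ^ k)) ⟩
        + U ℤ.* (+ suc q ℤ.* + (suc q ^ k)) ≡⟨ rearrange (+ U) (+ suc q) (+ (suc q ^ k)) ⟩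
        + (suc q ^ k) ℤ.* (+ suc q ℤ.* + U) ≡⟨ cong (ℤ._*_ (+ (suc q ^ k))) closed-form ⟩
        + (suc q ^ k) ℤ.* X                 ∎)
      where
      open ≡-Reasoning
      U : ℕ
      U = unitSolutions (suc q) (suc k) M
      X : ℤ
      X = (+ q) ℤ.^ suc k ℤ.+ -[1+ 0 ] ℤ.^ suc k ℤ.* δ (suc q) (suc k) a b c
      closed-form : + suc q ℤ.* + U ≡ X
      closed-form = unitSolutions-prime p-prime M (p·𝟙[p∣M]≡1+δ (suc q)) (suc k)
      rearrange : ∀ u p r → u ℤ.* (p ℤ.* r) ≡ r ℤ.* (p ℤ.* u)
      rearrange = ℤRing.solve-∀

    fromℕ-unitSolutions-product :
      ∀ ps → All Prime ps →
      fromℕ (unitSolutions (product ps) (suc k) M) ≡ fromℕ (product ps ^ k) ℚ.* primeProduct F (product ps)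
    fromℕ-unitSolutions-product [] [] =
      trans (cong fromℕ (unitSolutions-modulus-one (suc k) M))
            (sym (trans (cong (λ x → fromℕ x ℚ.* 1ℚ) (ℕP.^-zeroˡ k)) (ℚP.*-identityʳ _)))
    fromℕ-unitSolutions-product (p ∷ ps) (p-prime ∷ ps-prime) with p ℕD.∣? product ps
    ... | yes p∣q = begin
      fromℕ (unitSolutions (p * q) (suc k) M)
        ≡⟨ cong fromℕ (unitSolutions-∣ p q p∣q k M) ⟩
      fromℕ (p ^ k * unitSolutions q (suc k) M)
        ≡⟨ fromℕ-* (p ^ k) _ ⟩
      fromℕ (p ^ k) ℚ.* fromℕ (unitSolutions q (suc k) M)
        ≡⟨ cong (ℚ._*_ (fromℕ (p ^ k))) (fromℕ-unitSolutions-product ps ps-prime) ⟩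
      fromℕ (p ^ k) ℚ.* (fromℕ (q ^ k) ℚ.* primeProduct F q)
        ≡⟨ ℚP.*-assoc (fromℕ (p ^ k)) _ _ ⟨
      fromℕ (p ^ k) ℚ.* fromℕ (q ^ k) ℚ.* primeProduct F q
        ≡⟨ cong₂ ℚ._*_ (fromℕ-^-* p q k) (primeProduct-∣ F p-prime (productOfPrimes≥1 ps-prime) p∣q) ⟨
      fromℕ ((p * q) ^ k) ℚ.* primeProduct F (p * q) ∎
      where
      open ≡-Reasoning
      q : ℕ
      q = product ps
      instance
        _ = prime⇒nonZero p-prime
        _ = productOfPrimes≢0 ps-prime
    ... | no p∤q = begin
      fromℕ (unitSolutions (p * q) (suc k) M)
        ≡⟨ cong fromℕ (unitSolutions-* p q (prime-∤⇒coprime p-prime p∤q) (suc k) M) ⟩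
      fromℕ (unitSolutions p (suc k) M * unitSolutions q (suc k) M)
        ≡⟨ fromℕ-* (unitSolutions p (suc k) M) (unitSolutions q (suc k) M) ⟩
      fromℕ (unitSolutions p (suc k) M) ℚ.* fromℕ (unitSolutions q (suc k) M)
        ≡⟨ cong₂ ℚ._*_ (fromℕ-unitSolutions-prime p-prime) (fromℕ-unitSolutions-product ps ps-prime) ⟩
      (fromℕ (p ^ k) ℚ.* F p) ℚ.* (fromℕ (q ^ k) ℚ.* primeProduct F q)
        ≡⟨ ℚ-interchange (fromℕ (p ^ k)) (F p) _ _ ⟩
      (fromℕ (p ^ k) ℚ.* fromℕ (q ^ k)) ℚ.* (F p ℚ.* primeProduct F q)
        ≡⟨ cong₂ ℚ._*_ (fromℕ-^-* p q k) (primeProduct-∤ F p-prime (productOfPrimes≥1 ps-prime) p∤q) ⟨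
      fromℕ ((p * q) ^ k) ℚ.* primeProduct F (p * q) ∎
      where
      open ≡-Reasoning
      q : ℕ
      q = product ps
      instance _ = prime⇒nonZero p-prime

    fromℕ-unitSolutions : ∀ n .{{_ : NonZero n}} →
                          fromℕ (unitSolutions n (suc k) M) ≡ fromℕ (n ^ k) ℚ.* primeProduct F n
    fromℕ-unitSolutions n =
      subst (λ m → fromℕ (unitSolutions m (suc k) M) ≡ fromℕ (m ^ k) ℚ.* primeProduct F m)
            (sym isFactorisation) (fromℕ-unitSolutions-product factors factorsPrime)
      where open PrimeFactorisation (factorise n)

open import Data.Nat using (ℕ; _≤_; _∸_; _^_)
open import Data.Integer using (ℤ; +_)
open import Data.Integer.GCD using (gcd)
open import Data.Rational using (ℚ; 1ℚ; _*_; _/_)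
open import Data.List using (foldr; map)
open import Relation.Binary.PropositionalEquality using (_≡_)
open import Data.Nat using (zero; suc; >-nonZero)
open import Function using (Equivalence)
open import Relation.Binary.PropositionalEquality using (cong; trans)

theorem1p2 : (k : ℕ) (c : ℤ) (n : ℕ) (a b : ℤ) → 2 ≤ k → 1 ≤ n → gcd a (+ n) ≡ + 1 →
    (+ 𝒩 k a b c n) / 1 ≡ ((+ (n ^ (k ∸ 1))) / 1) * foldr _*_ 1ℚ (map (factor k a b c) (primeDivisors n))
theorem1p2 zero    c n a b ()
theorem1p2 (suc k) c n a b _ 1≤n gcd[a,n]≡1 =
  trans (cong fromℕ (𝒩≡unitSolutions a b n (Equivalence.to (gcd≡1⇔coprime a n) gcd[a,n]≡1) (suc k) c))
        (fromℕ-unitSolutions k a b c n)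
  where instance _ = >-nonZero 1≤n
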